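{- Let $n\ge 3$ and let $\underline{v_n}=s_2s_1s_3s_2s_4s_3\cdots s_{n-1}s_{n-2}$ (a reduced expression of the permutation $v_n=34\cdots n12\in\mathfrak{S}_n$). Then the set $\mathbb{L}_{\underline{v_n}}(e)$ can be constructed without using $6$-valent vertices; that is, there is an admissible construction of $\mathbb{T}_{\underline{v_n}}$ in which no element of $\mathbb{L}_{\underline{v_n}}(e)$ contains a $6$-valent vertex.
   Context: $\mathfrak{S}_n$ has Coxeter generators $s_i=(i,i+1)$, $1\le i<n$, with $m_{s_is_j}=3$ if $|i-j|=1$ and $2$ if $|i-j|\ge2$. Light leaves: An $S$-graph is a finite planar graph with boundary in $\mathbb{R}\times[0,1]$, edges coloured by $S$, vertices either univalent ("dots") or $2m_{st}$-valent with edges alternately coloured $s,t$; the top sequence is the word read on the top boundary. For a word $\underline{v}=s_1\cdots s_m$, the tree $\mathbb{T}_{\underline{v}}$ has root decorated by the empty diagram; a node of depth $k-1$ decorated by $D$ with top sequence a reduced expression $\underline{u}$ of $u$ has: if $\ell(us_k)>\ell(u)$, two children ($D$ plus an $s_k$-coloured straight strand on the right, top $\underline{u}s_k$; $D$ plus an $s_k$ strand ending in a dot on the right, top $\underline{u}$); if $\ell(us_k)<\ell(u)$, one child obtained by stacking $2m_{st}$-valent vertices on $D$ realizing some chosen sequence of braid moves from $\underline{u}$ to a reduced expression $\underline{u}''s_k$, then joining the rightmost top $s_k$ strand to a new $s_k$ strand from the bottom by an arc (top $\underline{u}''$). Any choice of braid moves gives an admissible construction. The leaves are the light leaves; $\mathbb{L}_{\underline{v}}(e)$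 is the set of light leaves with empty top sequence. -}

module Defs where

open import Data.Nat using (ℕ; zero; suc; _+_; _<_; _<ᵇ_)
open import Data.Bool using (Bool; true; false; _∨_; if_then_else_)
open import Data.List using (List; []; _∷_; _++_; [_]; foldl; map; upTo; length; filter; concatMap)
open import Data.Sum using (_⊎_)
open import Data.Product using (_×_)
open import Data.Unit using (⊤)
open import Relation.Binary.PropositionalEquality using (_≡_)

-- A word in the Coxeter generators s_1, ..., s_{n-1} of 𝔖_n;
-- the letter i stands for s_i = (i, i+1).
Word : Set
Word = List ℕ

-- Length function of 𝔖_n (number of inversions of the permutation
-- expressed by a word, in one-line notation).

swapAt : ℕ → List ℕ → List ℕ
swapAt (suc zero)    (a ∷ b ∷ r) = b ∷ a ∷ r
swapAt (suc (suc i)) (a ∷ r)     = a ∷ swapAt (suc i) r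
swapAt _             xs          = xs

-- one-line notation [w(1), ..., w(n)] of the product of the word in 𝔖_n
-- (right multiplication by s_i swaps positions i and i+1)
oneLine : ℕ → Word → List ℕ
oneLine n w = foldl (λ p i → swapAt i p) (map suc (upTo n)) w

countLess : ℕ → List ℕ → ℕ
countLess a []      = 0
countLess a (b ∷ r) = (if b <ᵇ a then 1 else 0) + countLess a r

inversions : List ℕ → ℕ
inversions []      = 0
inversions (a ∷ r) = countLess a r + inversions r

len : ℕ → Word → ℕ
len n w = inversions (oneLine n w)

-- Braid moves. Each braid move is realised by one 2m_{st}-valent vertex;
-- the Bool records whether that vertex is 6-valent (m_{st} = 3).

data BraidStep : Word → Word → Bool → Set where
  comm  : ∀ l r i j → (suc i < j ⊎ suc j < i) →
          BraidStep (l ++ (i ∷ j ∷ r)) (l ++ (j ∷ i ∷ r)) false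
  braid : ∀ l r i j → (suc i ≡ j ⊎ suc j ≡ i) →
          BraidStep (l ++ (i ∷ j ∷ i ∷ r)) (l ++ (j ∷ i ∷ j ∷ r)) true

data BraidSeq : Word → Word → Bool → Set where
  done : ∀ {u} → BraidSeq u u false
  step : ∀ {u v w b c} → BraidStep u v b → BraidSeq v w c → BraidSeq u w (b ∨ c)

-- Construction n u w : a construction of the subtree below a node whose
-- diagram has top sequence u, where w is the remaining part of the word.

data Construction (n : ℕ) : Word → Word → Set where
  leaf : ∀ {u} → Construction n u []
  -- ℓ(u s) > ℓ(u): two children (straight strand / dotted strand)
  up   : ∀ {u s w} → len n u < len n (u ++ [ s ]) →
         Construction n (u ++ [ s ]) w → Construction n u w →
         Construction n u (s ∷ w)
  -- ℓ(u s) < ℓ(u): a chosen sequence of braid moves u ⇝ u'' s, then an arc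
  down : ∀ {u s w} u'' {c} → len n (u ++ [ s ]) < len n u →
         BraidSeq u (u'' ++ [ s ]) c → Construction n u'' w →
         Construction n u (s ∷ w)

-- SixFreeOnE b T : every leaf of T with empty top sequence (i.e. every
-- element of 𝕃(e) below this node) contains no 6-valent vertex, where b
-- records whether the diagram at the current node already contains one.
SixFreeOnE : ∀ {n u w} → Bool → Construction n u w → Set
SixFreeOnE {u = u} b leaf = u ≡ [] → b ≡ false
SixFreeOnE b (up _ T₁ T₂) = SixFreeOnE b T₁ × SixFreeOnE b T₂
SixFreeOnE b (down _ {c} _ _ T) = SixFreeOnE (b ∨ c) T

vword : ℕ → Word
vword n = concatMap (λ i → suc (suc i) ∷ suc i ∷ []) (upTo (n Data.Nat.∸ 2))

-- The word v_n is a string of blocks s_{i+2} s_{i+1}.  Below every node reached after i blocks,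
-- the one-line notation of the top sequence u is A ++ W with length A = i and W increasing
-- ("ascending" state), or with the first two entries of W swapped ("swapped" state).  Only in
-- the swapped state is s_{i+1} ever a descent; there we carry in advance the braid moves
-- u ⇝ p s_{i+1} for its arc, p being the top sequence the arc will leave, and every top
-- sequence below the node extends p.  The only braid move ever needed is
-- s_{i+1} s_{i+2} s_{i+1} ↦ s_{i+2} s_{i+1} s_{i+2}, when a swapped node continues with two
-- ascents; there the pending top sequence becomes p s_{i+2} s_{i+1} ≠ [], so no element of
-- 𝕃(e) contains the 6-valent vertex.

module Submission where

open import Defs
open import Data.Nat using (ℕ; _≤_)
open import Data.Bool using (false)
open import Data.List using ([])
open import Data.Product using (Σ)

open import Algebra.Properties.CommutativeSemigroup using (x∙yz≈y∙xz)
open import Data.Bool using (Bool; true; _∨_; if_then_else_)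
open import Data.Bool.Properties using (T-≡; ¬-not; ∨-assoc; ∨-identityʳ)
open import Data.Empty using (⊥-elim)
open import Data.List using (List; _∷_; _++_; _∷ʳ_; [_]; map; applyUpTo; length; concatMap)
open import Data.List.Properties using (foldl-∷ʳ; ∷ʳ-++; ++-assoc; length-++; length-map; length-applyUpTo)
open import Data.List.Relation.Unary.All using (_∷_)
open import Data.List.Relation.Unary.AllPairs using (AllPairs; _∷_)
import Data.List.Relation.Unary.AllPairs.Properties as AllPairs
open import Data.Nat using (zero; suc; _+_; _<_; _<ᵇ_; s≤s)
open import Data.Nat.Properties
  using (+-commutativeSemigroup; +-monoʳ-<; <⇒<ᵇ; <ᵇ⇒<; <-asym; ≤-reflexive; 0≢1+n; +-identityʳ; +-suc)
open import Data.Product using (_,_; proj₁; proj₂)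
open import Data.Sum using (inj₁)
open import Function using (_∘_)
open import Function.Bundles using (Equivalence)
open import Relation.Binary.PropositionalEquality
  using (_≡_; _≢_; refl; sym; trans; cong; cong₂; subst; subst₂; module ≡-Reasoning)

<ᵇ-true : ∀ {m n} → m < n → (m <ᵇ n) ≡ true
<ᵇ-true = Equivalence.to T-≡ ∘ <⇒<ᵇ

<ᵇ-false : ∀ {m n} → m < n → (n <ᵇ m) ≡ false
<ᵇ-false {m} {n} m<n = ¬-not (λ n<ᵇm → <-asym m<n (<ᵇ⇒< n m (Equivalence.from T-≡ n<ᵇm)))

length-∷ʳ : ∀ {A : Set} (xs : List A) x → length (xs ∷ʳ x) ≡ suc (length xs)
length-∷ʳ []       x = refl
length-∷ʳ (_ ∷ xs) x = cong suc (length-∷ʳ xs x)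

∷ʳ≢[] : ∀ {A : Set} (xs : List A) x → xs ∷ʳ x ≢ []
∷ʳ≢[] []       x ()
∷ʳ≢[] (_ ∷ xs) x ()

∷ʳ³ : ∀ {A : Set} (xs : List A) a b c → xs ∷ʳ a ∷ʳ b ∷ʳ c ≡ xs ++ a ∷ b ∷ c ∷ []
∷ʳ³ []       a b c = refl
∷ʳ³ (x ∷ xs) a b c = cong (x ∷_) (∷ʳ³ xs a b c)

countLess-swap : ∀ a A y z R → countLess a (A ++ y ∷ z ∷ R) ≡ countLess a (A ++ z ∷ y ∷ R)
countLess-swap a []      y z R =
  x∙yz≈y∙xz +-commutativeSemigroup (if y <ᵇ a then 1 else 0) (if z <ᵇ a then 1 else 0) (countLess a R)
countLess-swap a (b ∷ A) y z R = cong (_ +_) (countLess-swap a A y z R)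

inversions-swap-< : ∀ A {y z} R → y < z →
                    inversions (A ++ y ∷ z ∷ R) < inversions (A ++ z ∷ y ∷ R)
inversions-swap-< [] {y} {z} R y<z rewrite <ᵇ-false y<z | <ᵇ-true y<z =
  s≤s (≤-reflexive (x∙yz≈y∙xz +-commutativeSemigroup (countLess y R) (countLess z R) (inversions R)))
inversions-swap-< (a ∷ A) {y} {z} R y<z rewrite countLess-swap a A y z R =
  +-monoʳ-< (countLess a (A ++ z ∷ y ∷ R)) (inversions-swap-< A R y<z)

swapAt-++ : ∀ A {a b : ℕ} {R} → swapAt (suc (length A)) (A ++ a ∷ b ∷ R) ≡ A ++ b ∷ a ∷ R
swapAt-++ []      = refl
swapAt-++ (c ∷ A) = cong (c ∷_) (swapAt-++ A)

braidStep-∷ʳ : ∀ {u v b} → BraidStep u v b → ∀ s → BraidStep (u ∷ʳ s) (v ∷ʳ s) b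
braidStep-∷ʳ (comm l r i j h) s
  rewrite ++-assoc l (i ∷ j ∷ r) [ s ] | ++-assoc l (j ∷ i ∷ r) [ s ] = comm l (r ∷ʳ s) i j h
braidStep-∷ʳ (braid l r i j h) s
  rewrite ++-assoc l (i ∷ j ∷ i ∷ r) [ s ] | ++-assoc l (j ∷ i ∷ j ∷ r) [ s ] = braid l (r ∷ʳ s) i j h

braidSeq-∷ʳ : ∀ {u v b} → BraidSeq u v b → ∀ s → BraidSeq (u ∷ʳ s) (v ∷ʳ s) b
braidSeq-∷ʳ done        s = done
braidSeq-∷ʳ (step st q) s = step (braidStep-∷ʳ st s) (braidSeq-∷ʳ q s)

braidSeq-trans : ∀ {u v w b c} → BraidSeq u v b → BraidSeq v w c → BraidSeq u w (b ∨ c)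
braidSeq-trans done                     q = q
braidSeq-trans {w = w} (step {b = b} {c = b′} st p) q =
  subst (BraidSeq _ w) (sym (∨-assoc b b′ _)) (step st (braidSeq-trans p q))

braidStep-length : ∀ {u v b} → BraidStep u v b → length u ≡ length v
braidStep-length (comm l r i j _)  = trans (length-++ l) (sym (length-++ l))
braidStep-length (braid l r i j _) = trans (length-++ l) (sym (length-++ l))

braidSeq-length : ∀ {u v b} → BraidSeq u v b → length u ≡ length v
braidSeq-length done        = refl
braidSeq-length (step st q) = trans (braidStep-length st) (braidSeq-length q)

braid-∷ʳ : ∀ p i → BraidStep (p ∷ʳ suc i ∷ʳ suc (suc i) ∷ʳ suc i)
                             (p ∷ʳ suc (suc i) ∷ʳ suc i ∷ʳ suc (suc i)) true
braid-∷ʳ p i = subst₂ (λ u v → BraidStep u v true) (sym (∷ʳ³ p _ _ _)) (sym (∷ʳ³ p _ _ _))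
                      (braid p [] (suc i) (suc (suc i)) (inj₁ refl))

braidSeq-source≢[] : ∀ {u p s c} → BraidSeq u (p ∷ʳ s) c → u ≢ []
braidSeq-source≢[] {p = p} {s} sq refl = 0≢1+n (trans (braidSeq-length sq) (length-∷ʳ p s))

vwordFrom : ℕ → ℕ → Word
vwordFrom i zero    = []
vwordFrom i (suc m) = suc (suc i) ∷ suc i ∷ vwordFrom (suc i) m

vwordFrom-applyUpTo : ∀ (g : ℕ → ℕ) i m → (∀ x → g x ≡ i + x) →
                      concatMap (λ j → suc (suc j) ∷ suc j ∷ []) (applyUpTo g m) ≡ vwordFrom i m
vwordFrom-applyUpTo g i zero    g≗i+ = refl
vwordFrom-applyUpTo g i (suc m) g≗i+ =
  cong₂ (λ j w → suc (suc j) ∷ suc j ∷ w) (trans (g≗i+ 0) (+-identityʳ i))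
        (vwordFrom-applyUpTo (g ∘ suc) (suc i) m (λ x → trans (g≗i+ (suc x)) (+-suc i x)))

vword≡vwordFrom : ∀ m → vword (2 + m) ≡ vwordFrom 0 m
vword≡vwordFrom m = vwordFrom-applyUpTo (λ x → x) 0 m (λ _ → refl)

oneLine-[]-ascending : ∀ n → AllPairs _<_ (oneLine n [])
oneLine-[]-ascending n = AllPairs.map⁺ (AllPairs.applyUpTo⁺₁ (λ x → x) n (λ i<j _ → s≤s i<j))

module _ (n : ℕ) where

  SixFreeConstruction : Word → Word → Bool → Set
  SixFreeConstruction u w b = Σ (Construction n u w) (SixFreeOnE b)

  oneLine-swap : ∀ u {A a b R k} → length A ≡ k → oneLine n u ≡ A ++ a ∷ b ∷ R →
                 oneLine n (u ∷ʳ suc k) ≡ A ++ b ∷ a ∷ R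
  oneLine-swap u {A} {a} {b} {R} refl ou = begin
    oneLine n (u ∷ʳ suc (length A))          ≡⟨ foldl-∷ʳ _ _ _ u ⟩
    swapAt (suc (length A)) (oneLine n u)    ≡⟨ cong (swapAt _) ou ⟩
    swapAt (suc (length A)) (A ++ a ∷ b ∷ R) ≡⟨ swapAt-++ A ⟩
    A ++ b ∷ a ∷ R                           ∎
    where open ≡-Reasoning

  len-ascent : ∀ u {A a b R k} → length A ≡ k → oneLine n u ≡ A ++ a ∷ b ∷ R → a < b →
               len n u < len n (u ∷ʳ suc k)
  len-ascent u {A = A} {R = R} eq ou a<b =
    subst₂ _<_ (cong inversions (sym ou)) (cong inversions (sym (oneLine-swap u eq ou)))
           (inversions-swap-< A R a<b)

  len-descent : ∀ u {A a b R k} → length A ≡ k → oneLine n u ≡ A ++ a ∷ b ∷ R → b < a →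
                len n (u ∷ʳ suc k) < len n u
  len-descent u {A = A} {R = R} eq ou b<a =
    subst₂ _<_ (cong inversions (sym (oneLine-swap u eq ou))) (cong inversions (sym ou))
           (inversions-swap-< A R b<a)

  mutual
    fromAscending : ∀ {i b} A {x y} R u → oneLine n u ≡ A ++ x ∷ y ∷ R →
                    AllPairs _<_ (x ∷ y ∷ R) → length A ≡ i → (u ≡ [] → b ≡ false) →
                    SixFreeConstruction u (vwordFrom i (length R)) b
    fromAscending A []      u _ _ _ u≡[]⇒b≡false = leaf , u≡[]⇒b≡false
    fromAscending {b = b} A {x} {y} (z ∷ R) u ou
                  ((x<y ∷ x<z ∷ x<R) ∷ (y<z ∷ y<R) ∷ zR@(_ ∷ R↑)) refl u≡[]⇒b≡false =
      up (len-ascent u (length-∷ʳ A x) ou₁ y<z)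
         (up (len-ascent (u ∷ʳ _) refl ou₂ x<z) (proj₁ T₁₁) (proj₁ T₁₂))
         (up (len-ascent u refl ou x<y) (proj₁ T₂₁) (proj₁ T₂₂))
      , (proj₂ T₁₁ , proj₂ T₁₂) , (proj₂ T₂₁ , proj₂ T₂₂)
      where
      ou₁ : oneLine n u ≡ A ∷ʳ x ++ y ∷ z ∷ R
      ou₁ = trans ou (sym (∷ʳ-++ A x _))
      ou₂ : oneLine n (u ∷ʳ suc (suc (length A))) ≡ A ++ x ∷ z ∷ y ∷ R
      ou₂ = trans (oneLine-swap u (length-∷ʳ A x) ou₁) (∷ʳ-++ A x _)
      Subtree : Word → Bool → Set
      Subtree v = SixFreeConstruction v (vwordFrom (suc (length A)) (length R))
      T₁₁ : Subtree (u ∷ʳ suc (suc (length A)) ∷ʳ suc (length A)) b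
      T₁₁ = fromAscending (A ∷ʳ z) R _ (trans (oneLine-swap (u ∷ʳ _) refl ou₂) (sym (∷ʳ-++ A z _)))
              ((x<y ∷ x<R) ∷ y<R ∷ R↑) (length-∷ʳ A z) (⊥-elim ∘ ∷ʳ≢[] _ _)
      T₁₂ : Subtree (u ∷ʳ suc (suc (length A))) b
      T₁₂ = fromSwapped (A ∷ʳ x) R _ u done (trans ou₂ (sym (∷ʳ-++ A x _))) ou₁
              ((y<z ∷ y<R) ∷ zR) (length-∷ʳ A x) (λ u≡[] → trans (∨-identityʳ b) (u≡[]⇒b≡false u≡[]))
      T₂₁ : Subtree (u ∷ʳ suc (length A)) b
      T₂₁ = fromAscending (A ∷ʳ y) R _ (trans (oneLine-swap u refl ou) (sym (∷ʳ-++ A y _)))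
              ((x<z ∷ x<R) ∷ zR) (length-∷ʳ A y) (⊥-elim ∘ ∷ʳ≢[] _ _)
      T₂₂ : Subtree u b
      T₂₂ = fromAscending (A ∷ʳ x) R u ou₁ ((y<z ∷ y<R) ∷ zR) (length-∷ʳ A x) u≡[]⇒b≡false

    fromSwapped : ∀ {i b c} A {x y} R u p → BraidSeq u (p ∷ʳ suc i) c →
                  oneLine n u ≡ A ++ y ∷ x ∷ R → oneLine n p ≡ A ++ x ∷ y ∷ R →
                  AllPairs _<_ (x ∷ y ∷ R) → length A ≡ i → (p ≡ [] → (b ∨ c) ≡ false) →
                  SixFreeConstruction u (vwordFrom i (length R)) b
    fromSwapped A []      u p sq _ _ _ _ _ = leaf , ⊥-elim ∘ braidSeq-source≢[] sq
    fromSwapped {b = b} {c} A {x} {y} (z ∷ R) u p sq ou op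
                ((x<y ∷ x<z ∷ x<R) ∷ (y<z ∷ y<R) ∷ zR@(_ ∷ R↑)) refl p≡[]⇒b∨c≡false =
      up (len-ascent u (length-∷ʳ A y) ou₁ x<z)
         (up (len-ascent (u ∷ʳ ssA) refl ou₂ y<z) (proj₁ T₁₁) (proj₁ T₁₂))
         (down p (len-descent u refl ou x<y) sq (proj₁ T₂))
      , (proj₂ T₁₁ , proj₂ T₁₂) , proj₂ T₂
      where
      sA ssA : ℕ
      sA = suc (length A)
      ssA = suc sA
      Subtree : Word → Bool → Set
      Subtree v = SixFreeConstruction v (vwordFrom sA (length R))
      ou₁ : oneLine n u ≡ A ∷ʳ y ++ x ∷ z ∷ R
      ou₁ = trans ou (sym (∷ʳ-++ A y _))
      ou₂ : oneLine n (u ∷ʳ ssA) ≡ A ++ y ∷ z ∷ x ∷ R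
      ou₂ = trans (oneLine-swap u (length-∷ʳ A y) ou₁) (∷ʳ-++ A y _)
      op₁ : oneLine n p ≡ A ∷ʳ x ++ y ∷ z ∷ R
      op₁ = trans op (sym (∷ʳ-++ A x _))
      op₂ : oneLine n (p ∷ʳ ssA) ≡ A ++ x ∷ z ∷ y ∷ R
      op₂ = trans (oneLine-swap p (length-∷ʳ A x) op₁) (∷ʳ-++ A x _)
      sq₁₁ : BraidSeq (u ∷ʳ ssA ∷ʳ sA) (p ∷ʳ ssA ∷ʳ sA ∷ʳ ssA) (c ∨ (true ∨ false))
      sq₁₁ = braidSeq-trans (braidSeq-∷ʳ (braidSeq-∷ʳ sq ssA) sA) (step (braid-∷ʳ p (length A)) done)
      T₁₁ : Subtree (u ∷ʳ ssA ∷ʳ sA) b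
      T₁₁ = fromSwapped (A ∷ʳ z) R _ (p ∷ʳ ssA ∷ʳ sA) sq₁₁
              (trans (oneLine-swap (u ∷ʳ ssA) refl ou₂) (sym (∷ʳ-++ A z _)))
              (trans (oneLine-swap (p ∷ʳ ssA) refl op₂) (sym (∷ʳ-++ A z _)))
              ((x<y ∷ x<R) ∷ y<R ∷ R↑) (length-∷ʳ A z) (⊥-elim ∘ ∷ʳ≢[] _ _)
      T₁₂ : Subtree (u ∷ʳ ssA) b
      T₁₂ = fromSwapped (A ∷ʳ y) R (u ∷ʳ ssA) (p ∷ʳ sA) (braidSeq-∷ʳ sq ssA)
              (trans ou₂ (sym (∷ʳ-++ A y _)))
              (trans (oneLine-swap p refl op) (sym (∷ʳ-++ A y _)))
              ((x<z ∷ x<R) ∷ zR) (length-∷ʳ A y) (⊥-elim ∘ ∷ʳ≢[] _ _)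
      T₂ : Subtree p (b ∨ c)
      T₂ = fromAscending (A ∷ʳ x) R p op₁ ((y<z ∷ y<R) ∷ zR) (length-∷ʳ A x) p≡[]⇒b∨c≡false

lemma4p2 : (n : ℕ) → 3 ≤ n →
    Σ (Construction n [] (vword n)) (λ T → SixFreeOnE false T)
lemma4p2 n@(suc (suc (suc k))) (s≤s (s≤s (s≤s _))) =
  subst (λ w → SixFreeConstruction n [] w false) (sym vword≡)
        (fromAscending n [] R [] refl (oneLine-[]-ascending n) refl (λ _ → refl))
  where
  g : ℕ → ℕ
  g x = suc (suc x)
  R : List ℕ
  R = map suc (applyUpTo g (suc k))
  vword≡ : vword n ≡ vwordFrom 0 (length R)
  vword≡ = trans (vword≡vwordFrom (suc k)) (cong (vwordFrom 0) (sym length-R))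
    where
    length-R : length R ≡ suc k
    length-R = trans (length-map suc (applyUpTo g (suc k))) (length-applyUpTo g (suc k))
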